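{- For every even integer $k\geq 2$, $\operatorname{rank}M_k=\left[\frac{3k}{4}\right]-1$.
   Context: For integers $j$, let $\delta_{j,\mathrm{ev}}=1$ if $j$ is even and $0$ otherwise, $\delta_{j,\mathrm{od}}=1-\delta_{j,\mathrm{ev}}$, and $\delta_{j,k-r}$ the Kronecker delta. For even $k$, $M_k$ is the $(k-2)\times(k-1)$ rational matrix with rows indexed by $1\le j\le k-2$, columns by $1\le r\le k-1$, and entries $$(-1)^r(1-\delta_{j,k-r})\delta_{j,\mathrm{od}}\binom{k-j-1}{r-1}+(-1)^r\delta_{j,\mathrm{ev}}\binom{k-j-1}{k-r-1}.$$ $[x]$ is the integer part of $x$. -}

module Defs where

open import Data.Nat as ℕ using (ℕ; zero; suc; _∸_; _≡ᵇ_)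
open import Data.Nat.Combinatorics using (_C_)
open import Data.Bool using (Bool; true; false; if_then_else_)
open import Data.Fin using (Fin; toℕ; zero; suc)
open import Data.Rational using (ℚ; 0ℚ; 1ℚ; _+_; _*_; -_; _/_)
open import Data.Integer using (+_)
open import Data.Product using (Σ; ∃; _×_)
open import Function.Definitions using (Injective)
open import Relation.Binary.PropositionalEquality using (_≡_; _≢_)

Matrix : ℕ → ℕ → Set
Matrix m n = Fin m → Fin n → ℚ

∑ : (n : ℕ) → (Fin n → ℚ) → ℚ
∑ zero    f = 0ℚ
∑ (suc n) f = f zero + ∑ n (λ i → f (suc i))

isEven : ℕ → Bool
isEven n = n ℕ.% 2 ≡ᵇ 0

sgn : ℕ → ℚ
sgn r = if isEven r then 1ℚ else - 1ℚ

-- Entry of M_k at (1-based) row j and column r.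
entry : (k j r : ℕ) → ℚ
entry k j r with isEven j
... | false = if (j ≡ᵇ (k ∸ r)) then 0ℚ
              else sgn r * ((+ ((k ∸ j ∸ 1) C (r ∸ 1))) / 1)
... | true  = sgn r * ((+ ((k ∸ j ∸ 1) C (k ∸ r ∸ 1))) / 1)

M : (k : ℕ) → Matrix (k ∸ 2) (k ∸ 1)
M k j r = entry k (suc (toℕ j)) (suc (toℕ r))

lincomb : ∀ {s n} → (Fin s → Fin n → ℚ) → (Fin s → ℚ) → Fin n → ℚ
lincomb {s} v a c = ∑ s (λ i → a i * v i c)

LinIndep : ∀ {s n} → (Fin s → Fin n → ℚ) → Set
LinIndep {s} v = ∀ (a : Fin s → ℚ) → (∀ c → lincomb v a c ≡ 0ℚ) → ∀ i → a i ≡ 0ℚ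

LinDep : ∀ {s n} → (Fin s → Fin n → ℚ) → Set
LinDep {s} v = Σ (Fin s → ℚ) λ a → (∃ λ i → a i ≢ 0ℚ) × (∀ c → lincomb v a c ≡ 0ℚ)

HasRank : ∀ {m n} → Matrix m n → ℕ → Set
HasRank {m} A ρ =
  (Σ (Fin ρ → Fin m) λ f → Injective _≡_ _≡_ f × LinIndep (λ i → A (f i)))
  × (∀ (g : Fin (suc ρ) → Fin m) → Injective _≡_ _≡_ g → LinDep (λ i → A (g i)))

module Submission where

-- Put n = k − 2 = 2h and read row i + 1 of M_k, indexed by c + 1 with c ≤ n, as the coefficient
-- sequence (in X^c) of a polynomial of degree ≤ n: for odd i it is −X^i (X−1)^(n−i), for even i it
-- is X^m − (X−1)^m with m = n − i.  Change to the basis X^a (X−1)^(n−a), a ≤ n, whose coefficient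
-- matrix is triangular.  The odd rows become negated unit vectors, and since X − (X−1) = 1 the
-- coordinates of X^m and of (X−1)^m are the coefficients of X^m (X−1)^i and of (X−1)^i, so the
-- even rows become antisymmetric under a ↦ n − a.  Hence every combination w of rows satisfies
-- w(a) + w(n − a) = 0 for even a and is determined by its values at the h odd positions and at
-- the ⌈h/2⌉ positions n, n − 2, …, n − 2⌈h/2⌉ + 2; conversely the odd rows together with the rows
-- 0, 2, …, 2⌈h/2⌉ − 2 are triangular with respect to these positions.  So the rank is
-- h + ⌈h/2⌉ = [3k/4] − 1.

open import Defs
open import Data.Nat as ℕ using (ℕ; zero; suc; z≤n; s≤s; _∸_; _≤_; _<_)
import Data.Nat.Properties as ℕₚ
import Data.Nat.DivMod as DivMod
open import Data.Nat.Divisibility using (_∣_; divides; divides-refl)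
open import Data.Nat.Tactic.RingSolver using (solve-∀)
open import Data.Nat.Combinatorics using (_C_; nCk+nC[k+1]≡[n+1]C[k+1]; k>n⇒nCk≡0; nCk≡nC[n∸k]; nCn≡1)
open import Data.Bool using (true; false; not; if_then_else_)
open import Data.Fin as Fin using (Fin; zero; suc; toℕ; punchIn; fromℕ)
import Data.Fin.Properties as Finₚ
import Data.Integer as ℤ
import Data.Integer.Properties as ℤₚ
import Data.Nat.Coprimality as Coprime
open import Data.Rational using (ℚ; 0ℚ; 1ℚ; _+_; _*_; -_; _-_; _/_; 1/_; mkℚ; ≢-nonZero)
import Data.Rational.Properties as ℚₚ
open import Data.Rational.Solver using (module +-*-Solver)
open import Algebra.Bundles using (CommutativeRing)
import Algebra.Properties.Semiring.Sum as SemiringSum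
open import Data.Vec.Functional using (removeAt; insertAt)
open import Data.Vec.Functional.Properties using (insertAt-lookup; insertAt-punchIn)
open import Data.Product using (_,_)
open import Data.Empty using (⊥-elim)
open import Function using (_∘_)
open import Function.Definitions using (Injective)
open import Relation.Nullary using (Dec; does; yes; no)
open import Relation.Nullary.Decidable using (dec-true; dec-false)
open import Relation.Binary.PropositionalEquality

open +-*-Solver

p*q≡0⇒q≡0 : ∀ {p q} → p ≢ 0ℚ → p * q ≡ 0ℚ → q ≡ 0ℚ
p*q≡0⇒q≡0 {p} {q} p≢0 pq≡0 = begin
  q              ≡⟨ sym (ℚₚ.*-identityˡ q) ⟩
  1ℚ * q         ≡⟨ cong (_* q) (sym (ℚₚ.*-inverseˡ p)) ⟩
  1/ p * p * q   ≡⟨ ℚₚ.*-assoc (1/ p) p q ⟩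
  1/ p * (p * q) ≡⟨ cong (1/ p *_) pq≡0 ⟩
  1/ p * 0ℚ      ≡⟨ ℚₚ.*-zeroʳ (1/ p) ⟩
  0ℚ             ∎
  where
  open ≡-Reasoning
  instance _ = ≢-nonZero p≢0

*-≢0 : ∀ {p q} → p ≢ 0ℚ → q ≢ 0ℚ → p * q ≢ 0ℚ
*-≢0 p≢0 q≢0 = q≢0 ∘ p*q≡0⇒q≡0 p≢0

x+x≡0⇒x≡0 : ∀ {x} → x + x ≡ 0ℚ → x ≡ 0ℚ
x+x≡0⇒x≡0 {x} x+x≡0 =
  p*q≡0⇒q≡0 {1ℚ + 1ℚ} (λ ()) (trans (solve 1 (λ x → (con 1ℚ :+ con 1ℚ) :* x := x :+ x) refl x) x+x≡0)

1≢-1 : 1ℚ ≢ - 1ℚ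
1≢-1 ()

-- The embedding through which Defs.entry writes its binomial coefficients.
toℚ : ℕ → ℚ
toℚ n = ℤ.+ n / 1

-- Both sides normalise the fraction (m · 1 + n · 1) / (1 · 1).
toℚ-+ : ∀ m n → toℚ (m ℕ.+ n) ≡ toℚ m + toℚ n
toℚ-+ m n = trans (ℚₚ./-cong (sym (cong₂ ℤ._+_ (ℤₚ.*-identityʳ (ℤ.+ m)) (ℤₚ.*-identityʳ (ℤ.+ n)))) refl)
                  (sym (cong₂ _+_ (toℚ≡mkℚ m) (toℚ≡mkℚ n)))
  where
  toℚ≡mkℚ : ∀ m → toℚ m ≡ mkℚ (ℤ.+ m) 0 (Coprime.sym (Coprime.1-coprimeTo m))
  toℚ≡mkℚ m = ℚₚ.normalize-coprime (Coprime.sym (Coprime.1-coprimeTo m))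

sgn-suc : ∀ n → sgn (suc n) ≡ - sgn n
sgn-suc zero          = refl
sgn-suc (suc zero)    = refl
sgn-suc (suc (suc n)) = sgn-suc n

sgn-+ : ∀ m n → sgn (m ℕ.+ n) ≡ sgn m * sgn n
sgn-+ zero          n = sym (ℚₚ.*-identityˡ (sgn n))
sgn-+ (suc zero)    n = trans (sgn-suc n) (solve 1 (λ x → :- x := con (- 1ℚ) :* x) refl (sgn n))
sgn-+ (suc (suc m)) n = sgn-+ m n

sgn*sgn : ∀ n → sgn n * sgn n ≡ 1ℚ
sgn*sgn zero          = refl
sgn*sgn (suc zero)    = refl
sgn*sgn (suc (suc n)) = sgn*sgn n

sgn[n+n] : ∀ n → sgn (n ℕ.+ n) ≡ 1ℚ
sgn[n+n] n = trans (sgn-+ n n) (sgn*sgn n)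

sgn-∸ : ∀ {m n} → n ≤ m → sgn (m ∸ n) ≡ sgn m * sgn n
sgn-∸ {m} {n} n≤m = begin
  sgn (m ∸ n)                   ≡⟨ sym (ℚₚ.*-identityʳ _) ⟩
  sgn (m ∸ n) * 1ℚ              ≡⟨ cong (sgn (m ∸ n) *_) (sym (sgn*sgn n)) ⟩
  sgn (m ∸ n) * (sgn n * sgn n) ≡⟨ sym (ℚₚ.*-assoc (sgn (m ∸ n)) (sgn n) (sgn n)) ⟩
  sgn (m ∸ n) * sgn n * sgn n   ≡⟨ cong (_* sgn n) (sym (sgn-+ (m ∸ n) n)) ⟩
  sgn (m ∸ n ℕ.+ n) * sgn n     ≡⟨ cong (λ k → sgn k * sgn n) (ℕₚ.m∸n+n≡m n≤m) ⟩
  sgn m * sgn n                 ∎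
  where open ≡-Reasoning

sgn-+ˡ : ∀ m → sgn m ≡ 1ℚ → ∀ n → sgn (m ℕ.+ n) ≡ sgn n
sgn-+ˡ m m-even n = trans (sgn-+ m n) (trans (cong (_* sgn n) m-even) (ℚₚ.*-identityˡ (sgn n)))

sgn≢0 : ∀ n → sgn n ≢ 0ℚ
sgn≢0 zero          ()
sgn≢0 (suc zero)    ()
sgn≢0 (suc (suc n)) = sgn≢0 n

isEven-suc : ∀ n → isEven (suc n) ≡ not (isEven n)
isEven-suc zero          = refl
isEven-suc (suc zero)    = refl
isEven-suc (suc (suc n)) = isEven-suc n

isEven-double : ∀ u → isEven (u ℕ.+ u) ≡ true
isEven-double zero    = refl
isEven-double (suc u) = trans (cong (isEven ∘ suc) (ℕₚ.+-suc u u)) (isEven-double u)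

isEven⇒sgn≡1 : ∀ {n} → isEven n ≡ true → sgn n ≡ 1ℚ
isEven⇒sgn≡1 even rewrite even = refl

isOdd⇒sgn≡-1 : ∀ {n} → isEven n ≡ false → sgn n ≡ - 1ℚ
isOdd⇒sgn≡-1 odd rewrite odd = refl

data Parity : ℕ → Set where
  twice   : ∀ u → Parity (u ℕ.+ u)
  twice+1 : ∀ u → Parity (suc (u ℕ.+ u))

parity : ∀ n → Parity n
parity zero    = twice 0
parity (suc n) with parity n
... | twice u   = twice+1 u
... | twice+1 u = subst Parity (cong suc (ℕₚ.+-suc u u)) (twice (suc u))

double-∸ : ∀ m n → (m ℕ.+ m) ∸ (n ℕ.+ n) ≡ (m ∸ n) ℕ.+ (m ∸ n)
double-∸ m       zero    = refl
double-∸ zero    (suc n) = refl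
double-∸ (suc m) (suc n) = trans (cong₂ _∸_ (ℕₚ.+-suc m m) (ℕₚ.+-suc n n)) (double-∸ m n)

double-cancel-≤ : ∀ {m n} → m ℕ.+ m ≤ n ℕ.+ n → m ≤ n
double-cancel-≤ m+m≤n+n = ℕₚ.≮⇒≥ λ n<m → ℕₚ.<⇒≱ (ℕₚ.+-mono-< n<m n<m) m+m≤n+n

double+1-cancel-< : ∀ {m n} → suc (m ℕ.+ m) ≤ n ℕ.+ n → m < n
double+1-cancel-< m+m<n+n = ℕₚ.≰⇒> λ n≤m → ℕₚ.<⇒≱ m+m<n+n (ℕₚ.+-mono-≤ n≤m n≤m)

double-injective : ∀ {m n} → m ℕ.+ m ≡ n ℕ.+ n → m ≡ n
double-injective eq =
  ℕₚ.≤-antisym (double-cancel-≤ (ℕₚ.≤-reflexive eq)) (double-cancel-≤ (ℕₚ.≤-reflexive (sym eq)))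

double+1≢double : ∀ u v → suc (u ℕ.+ u) ≢ v ℕ.+ v
double+1≢double u v eq = 1≢-1 (begin
  1ℚ                  ≡⟨ sym (sgn[n+n] v) ⟩
  sgn (v ℕ.+ v)       ≡⟨ cong sgn (sym eq) ⟩
  sgn (suc (u ℕ.+ u)) ≡⟨ sgn-suc (u ℕ.+ u) ⟩
  - sgn (u ℕ.+ u)     ≡⟨ cong -_ (sgn[n+n] u) ⟩
  - 1ℚ                ∎)
  where open ≡-Reasoning

module Sum = SemiringSum (CommutativeRing.semiring ℚₚ.+-*-commutativeRing)

∑≡sum : ∀ {n} (f : Fin n → ℚ) → ∑ n f ≡ Sum.sum f
∑≡sum {zero}  f = refl
∑≡sum {suc n} f = cong (f zero +_) (∑≡sum (f ∘ suc))

∑-cong : ∀ {n} {f g : Fin n → ℚ} → (∀ i → f i ≡ g i) → ∑ n f ≡ ∑ n g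
∑-cong {f = f} {g} f≗g rewrite ∑≡sum f | ∑≡sum g = Sum.sum-cong-≗ f≗g

∑-zero : ∀ {n} {f : Fin n → ℚ} → (∀ i → f i ≡ 0ℚ) → ∑ n f ≡ 0ℚ
∑-zero {n} f≗0 = trans (∑-cong f≗0) (trans (∑≡sum {n} (λ _ → 0ℚ)) (Sum.sum-replicate-zero n))

∑-distrib-+ : ∀ {n} (f g : Fin n → ℚ) → ∑ n (λ i → f i + g i) ≡ ∑ n f + ∑ n g
∑-distrib-+ f g rewrite ∑≡sum (λ i → f i + g i) | ∑≡sum f | ∑≡sum g = Sum.∑-distrib-+ f g

*-distribˡ-∑ : ∀ {n} x (f : Fin n → ℚ) → x * ∑ n f ≡ ∑ n (λ i → x * f i)
*-distribˡ-∑ x f rewrite ∑≡sum f | ∑≡sum (λ i → x * f i) = Sum.*-distribˡ-sum x f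

∑-comm : ∀ {m n} (f : Fin m → Fin n → ℚ) → ∑ m (λ i → ∑ n (f i)) ≡ ∑ n (λ j → ∑ m (λ i → f i j))
∑-comm {m} {n} f = begin
  ∑ m (λ i → ∑ n (f i))                 ≡⟨ ∑-cong (λ i → ∑≡sum (f i)) ⟩
  ∑ m (λ i → Sum.sum (f i))             ≡⟨ ∑≡sum (λ i → Sum.sum (f i)) ⟩
  Sum.sum (λ i → Sum.sum (f i))         ≡⟨ Sum.∑-comm f ⟩
  Sum.sum (λ j → Sum.sum (λ i → f i j)) ≡⟨ sym (∑≡sum (λ j → Sum.sum (λ i → f i j))) ⟩
  ∑ n (λ j → Sum.sum (λ i → f i j))     ≡⟨ sym (∑-cong (λ j → ∑≡sum (λ i → f i j))) ⟩
  ∑ n (λ j → ∑ m (λ i → f i j))         ∎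
  where open ≡-Reasoning

∑-remove : ∀ {n} (f : Fin (suc n) → ℚ) (q : Fin (suc n)) → ∑ (suc n) f ≡ f q + ∑ n (removeAt f q)
∑-remove f q rewrite ∑≡sum f | ∑≡sum (removeAt f q) = Sum.sum-remove {i = q} f

∑-neg : ∀ {n} (f : Fin n → ℚ) → ∑ n (λ i → - f i) ≡ - ∑ n f
∑-neg {zero}  f = refl
∑-neg {suc n} f = trans (cong (- f zero +_) (∑-neg (f ∘ suc))) (sym (ℚₚ.neg-distrib-+ (f zero) (∑ n (f ∘ suc))))

lincomb-punchIn : ∀ {s n} (v : Fin (suc s) → Fin n → ℚ) (a : Fin (suc s) → ℚ) (q : Fin (suc s)) c →
                  lincomb v a c ≡ a q * v q c + lincomb (v ∘ punchIn q) (a ∘ punchIn q) c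
lincomb-punchIn v a q c = ∑-remove (λ i → a i * v i c) q

lincomb-∘ : ∀ {s m n} (w : Fin s → Fin m → ℚ) (t : Fin m → Fin n → ℚ) (x : Fin s → ℚ) c →
            lincomb (λ i → lincomb t (w i)) x c ≡ lincomb t (lincomb w x) c
lincomb-∘ {s} {m} w t x c = begin
  ∑ s (λ i → x i * ∑ m (λ a → w i a * t a c))   ≡⟨ ∑-cong (λ i → *-distribˡ-∑ (x i) (λ a → w i a * t a c)) ⟩
  ∑ s (λ i → ∑ m (λ a → x i * (w i a * t a c))) ≡⟨ ∑-comm (λ i a → x i * (w i a * t a c)) ⟩
  ∑ m (λ a → ∑ s (λ i → x i * (w i a * t a c))) ≡⟨ ∑-cong (λ a → ∑-cong (λ i → reassoc (x i) (w i a) (t a c))) ⟩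
  ∑ m (λ a → ∑ s (λ i → t a c * (x i * w i a))) ≡⟨ ∑-cong (λ a → sym (*-distribˡ-∑ (t a c) (λ i → x i * w i a))) ⟩
  ∑ m (λ a → t a c * ∑ s (λ i → x i * w i a))   ≡⟨ ∑-cong (λ a → ℚₚ.*-comm (t a c) _) ⟩
  ∑ m (λ a → ∑ s (λ i → x i * w i a) * t a c)   ∎
  where
  open ≡-Reasoning
  reassoc : ∀ x w t → x * (w * t) ≡ t * (x * w)
  reassoc = solve 3 (λ x w t → x :* (w :* t) := t :* (x :* w)) refl

LinIndep-punchIn : ∀ {s n} (v : Fin (suc s) → Fin n → ℚ) (q : Fin (suc s)) (c : Fin n) →
                   v q c ≢ 0ℚ → (∀ j → v (punchIn q j) c ≡ 0ℚ) →
                   LinIndep (v ∘ punchIn q) → LinIndep v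
LinIndep-punchIn v q c vqc≢0 others-vanish others-indep a comb≡0 = a≡0
  where
  open ≡-Reasoning
  a′ = a ∘ punchIn q
  others-comb : ∀ c′ → lincomb v a c′ ≡ a q * v q c′ + lincomb (v ∘ punchIn q) a′ c′
  others-comb = lincomb-punchIn v a q
  aq≡0 : a q ≡ 0ℚ
  aq≡0 = p*q≡0⇒q≡0 vqc≢0 (begin
    v q c * a q                                ≡⟨ ℚₚ.*-comm (v q c) (a q) ⟩
    a q * v q c                                ≡⟨ sym (ℚₚ.+-identityʳ _) ⟩
    a q * v q c + 0ℚ                           ≡⟨ cong (a q * v q c +_) (sym (∑-zero λ j →
                                                    trans (cong (a′ j *_) (others-vanish j)) (ℚₚ.*-zeroʳ (a′ j)))) ⟩
    a q * v q c + lincomb (v ∘ punchIn q) a′ c ≡⟨ sym (others-comb c) ⟩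
    lincomb v a c                              ≡⟨ comb≡0 c ⟩
    0ℚ                                         ∎)
  a′≡0 : ∀ j → a′ j ≡ 0ℚ
  a′≡0 = others-indep a′ λ c′ → begin
    lincomb (v ∘ punchIn q) a′ c′                ≡⟨ sym (ℚₚ.+-identityˡ _) ⟩
    0ℚ + lincomb (v ∘ punchIn q) a′ c′           ≡⟨ cong (_+ lincomb (v ∘ punchIn q) a′ c′)
                                                          (sym (trans (cong (_* v q c′) aq≡0) (ℚₚ.*-zeroˡ (v q c′)))) ⟩
    a q * v q c′ + lincomb (v ∘ punchIn q) a′ c′ ≡⟨ sym (others-comb c′) ⟩
    lincomb v a c′                               ≡⟨ comb≡0 c′ ⟩
    0ℚ                                           ∎
  a≡0 : ∀ i → a i ≡ 0ℚ
  a≡0 i with q Fin.≟ i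
  ... | yes refl = aq≡0
  ... | no q≢i   = trans (cong a (sym (Finₚ.punchIn-punchOut q≢i))) (a′≡0 _)

lowerTriangular⇒LinIndep : ∀ {s n} (v : Fin s → Fin n → ℚ) (p : Fin s → Fin n) →
                           (∀ l i → toℕ l < toℕ i → v i (p l) ≡ 0ℚ) → (∀ l → v l (p l) ≢ 0ℚ) →
                           LinIndep v
lowerTriangular⇒LinIndep {zero}  v p lower diag a _ ()
lowerTriangular⇒LinIndep {suc s} v p lower diag =
  LinIndep-punchIn v zero (p zero) (diag zero) (λ j → lower zero (suc j) (s≤s z≤n))
    (lowerTriangular⇒LinIndep (v ∘ suc) (p ∘ suc) (λ l i l<i → lower (suc l) (suc i) (s≤s l<i)) (diag ∘ suc))

toℕ-punchIn-fromℕ : ∀ {s} (j : Fin s) → toℕ (punchIn (fromℕ s) j) ≡ toℕ j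
toℕ-punchIn-fromℕ zero    = refl
toℕ-punchIn-fromℕ (suc j) = cong suc (toℕ-punchIn-fromℕ j)

upperTriangular⇒LinIndep : ∀ {s n} (v : Fin s → Fin n → ℚ) (p : Fin s → Fin n) →
                           (∀ l i → toℕ i < toℕ l → v i (p l) ≡ 0ℚ) → (∀ l → v l (p l) ≢ 0ℚ) →
                           LinIndep v
upperTriangular⇒LinIndep {zero}  v p upper diag a _ ()
upperTriangular⇒LinIndep {suc s} v p upper diag =
  LinIndep-punchIn v (fromℕ s) (p (fromℕ s)) (diag (fromℕ s)) (λ j → upper (fromℕ s) _ (before-last j))
    (upperTriangular⇒LinIndep (v ∘ punchIn (fromℕ s)) (p ∘ punchIn (fromℕ s))
      (λ l i i<l → upper _ _ (subst₂ _<_ (sym (toℕ-punchIn-fromℕ i)) (sym (toℕ-punchIn-fromℕ l)) i<l))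
      (diag ∘ punchIn (fromℕ s)))
  where
  before-last : ∀ j → toℕ (punchIn (fromℕ s) j) < toℕ (fromℕ s)
  before-last j = subst₂ _<_ (sym (toℕ-punchIn-fromℕ j)) (sym (Finₚ.toℕ-fromℕ s)) (Finₚ.toℕ<n j)

LinDep-tail : ∀ {s m} (v : Fin s → Fin (suc m) → ℚ) → (∀ i → v i zero ≡ 0ℚ) →
              LinDep (λ i l → v i (suc l)) → LinDep v
LinDep-tail v column≡0 (x , nontrivial , comb≡0) = x , nontrivial , λ where
  zero    → ∑-zero (λ i → trans (cong (x i *_) (column≡0 i)) (ℚₚ.*-zeroʳ (x i)))
  (suc l) → comb≡0 l

eliminate : ∀ {s m} → (Fin (suc s) → Fin (suc m) → ℚ) → Fin (suc s) → Fin s → Fin m → ℚ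
eliminate v p i l = v p zero * v (punchIn p i) (suc l) - v (punchIn p i) zero * v p (suc l)

lincomb-eliminate : ∀ {s m} (v : Fin (suc s) → Fin (suc m) → ℚ) p (y : Fin s → ℚ) l →
                    lincomb (eliminate v p) y l
                      ≡ v p zero * lincomb (v ∘ punchIn p) y (suc l) - lincomb (v ∘ punchIn p) y zero * v p (suc l)
lincomb-eliminate {s} v p y l = begin
  ∑ s (λ i → y i * (π * A i - B i * e))                       ≡⟨ ∑-cong (λ i → distribute (y i) (A i) (B i)) ⟩
  ∑ s (λ i → π * (y i * A i) + - e * (y i * B i))             ≡⟨ ∑-distrib-+ (λ i → π * (y i * A i)) (λ i → - e * (y i * B i)) ⟩
  ∑ s (λ i → π * (y i * A i)) + ∑ s (λ i → - e * (y i * B i)) ≡⟨ sym (cong₂ _+_ (*-distribˡ-∑ π (λ i → y i * A i))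
                                                                                (*-distribˡ-∑ (- e) (λ i → y i * B i))) ⟩
  π * ∑ s (λ i → y i * A i) + - e * ∑ s (λ i → y i * B i)     ≡⟨ solve 4 (λ π a b e → π :* a :+ (:- e) :* b := π :* a :- b :* e)
                                                                         refl π (∑ s (λ i → y i * A i)) (∑ s (λ i → y i * B i)) e ⟩
  π * ∑ s (λ i → y i * A i) - ∑ s (λ i → y i * B i) * e       ∎
  where
  open ≡-Reasoning
  π = v p zero
  e = v p (suc l)
  A B : Fin s → ℚ
  A i = v (punchIn p i) (suc l)
  B i = v (punchIn p i) zero
  distribute : ∀ y a b → y * (π * a - b * e) ≡ π * (y * a) + - e * (y * b)
  distribute y a b = solve 5 (λ y a b π e → y :* (π :* a :- b :* e) := π :* (y :* a) :+ (:- e) :* (y :* b)) refl y a b π e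

-- A dependence y of the eliminated rows lifts with weight v p 0 · y i on row punchIn p i
-- and weight −Σ y i · v (punchIn p i) 0 on the pivot row p.
LinDep-eliminate : ∀ {s m} (v : Fin (suc s) → Fin (suc m) → ℚ) (p : Fin (suc s)) → v p zero ≢ 0ℚ →
                   LinDep (eliminate v p) → LinDep v
LinDep-eliminate {s} v p pivot≢0 (y , (j , yj≢0) , comb≡0) = x , (punchIn p j , xj≢0) , x-comb≡0
  where
  open ≡-Reasoning
  π = v p zero
  S : Fin _ → ℚ
  S = lincomb (v ∘ punchIn p) y
  x : Fin (suc s) → ℚ
  x = insertAt (λ i → π * y i) p (- S zero)
  xj≢0 : x (punchIn p j) ≢ 0ℚ
  xj≢0 = subst (_≢ 0ℚ) (sym (insertAt-punchIn (λ i → π * y i) p (- S zero) j)) (*-≢0 pivot≢0 yj≢0)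
  x-comb : ∀ c → lincomb v x c ≡ - S zero * v p c + π * S c
  x-comb c = begin
    lincomb v x c                                                  ≡⟨ lincomb-punchIn v x p c ⟩
    x p * v p c + ∑ s (λ i → x (punchIn p i) * v (punchIn p i) c)
      ≡⟨ cong₂ _+_ (cong (_* v p c) (insertAt-lookup (λ i → π * y i) p (- S zero)))
                   (∑-cong λ i → trans (cong (_* v (punchIn p i) c) (insertAt-punchIn (λ i → π * y i) p (- S zero) i))
                                       (ℚₚ.*-assoc π (y i) (v (punchIn p i) c))) ⟩
    - S zero * v p c + ∑ s (λ i → π * (y i * v (punchIn p i) c))
      ≡⟨ cong (- S zero * v p c +_) (sym (*-distribˡ-∑ π (λ i → y i * v (punchIn p i) c))) ⟩
    - S zero * v p c + π * S c                                     ∎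
  x-comb≡0 : ∀ c → lincomb v x c ≡ 0ℚ
  x-comb≡0 zero    = trans (x-comb zero) (solve 2 (λ σ π → (:- σ) :* π :+ π :* σ := con 0ℚ) refl (S zero) π)
  x-comb≡0 (suc l) = begin
    lincomb v x (suc l)                    ≡⟨ x-comb (suc l) ⟩
    - S zero * v p (suc l) + π * S (suc l) ≡⟨ solve 4 (λ σ e π τ → (:- σ) :* e :+ π :* τ := π :* τ :- σ :* e)
                                                      refl (S zero) (v p (suc l)) π (S (suc l)) ⟩
    π * S (suc l) - S zero * v p (suc l)   ≡⟨ sym (lincomb-eliminate v p y l) ⟩
    lincomb (eliminate v p) y l            ≡⟨ comb≡0 l ⟩
    0ℚ                                     ∎

m<s⇒LinDep : ∀ {m s} → m < s → (v : Fin s → Fin m → ℚ) → LinDep v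
m<s⇒LinDep {zero}  {suc s} _         v = (λ _ → 1ℚ) , (zero , ℚₚ.1≢0) , λ ()
m<s⇒LinDep {suc m} {suc s} (s≤s m<s) v with Finₚ.all? (λ i → v i zero ℚₚ.≟ 0ℚ)
... | yes column≡0 = LinDep-tail v column≡0 (m<s⇒LinDep (ℕₚ.m<n⇒m<1+n m<s) (λ i l → v i (suc l)))
... | no column≢0  = let p , pivot≢0 = Finₚ.¬∀⟶∃¬ _ _ (λ i → v i zero ℚₚ.≟ 0ℚ) column≢0
                     in LinDep-eliminate v p pivot≢0 (m<s⇒LinDep m<s (eliminate v p))

determined⇒LinDep : ∀ {s ρ n} (v : Fin s → Fin n → ℚ) (p : Fin ρ → Fin n) → ρ < s →
                    (∀ x → (∀ l → lincomb v x (p l) ≡ 0ℚ) → ∀ c → lincomb v x c ≡ 0ℚ) → LinDep v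
determined⇒LinDep v p ρ<s determined =
  let x , nontrivial , comb≡0 = m<s⇒LinDep ρ<s (λ i l → v i (p l))
  in x , nontrivial , determined x comb≡0

_·_ : ∀ {m n N} → Matrix m n → Matrix n N → Matrix m N
(E · T) j = lincomb T (E j)

HasRank-·-LinIndep : ∀ {m n N ρ} (E : Matrix m n) (T : Matrix n N) → LinIndep T →
                     HasRank E ρ → HasRank (E · T) ρ
HasRank-·-LinIndep E T T-indep ((f , f-inj , Ef-indep) , E-dep) = (f , f-inj , indep) , dep
  where
  indep : LinIndep ((E · T) ∘ f)
  indep a comb≡0 = Ef-indep a (T-indep (lincomb (E ∘ f) a) λ c → trans (sym (lincomb-∘ (E ∘ f) T a c)) (comb≡0 c))
  dep : ∀ g → Injective _≡_ _≡_ g → LinDep ((E · T) ∘ g)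
  dep g g-inj =
    let x , nontrivial , Eg-comb≡0 = E-dep g g-inj
    in x , nontrivial , λ c → trans (lincomb-∘ (E ∘ g) T x c)
                                    (∑-zero λ a → trans (cong (_* T a c) (Eg-comb≡0 a)) (ℚₚ.*-zeroˡ (T a c)))

HasRank-cong : ∀ {m n ρ} {A B : Matrix m n} → (∀ j c → A j c ≡ B j c) → HasRank A ρ → HasRank B ρ
HasRank-cong {A = A} {B} A≗B ((f , f-inj , Af-indep) , A-dep) =
  (f , f-inj , λ a comb≡0 → Af-indep a λ c → trans (lincomb-cong f a c) (comb≡0 c)) ,
  λ g g-inj → let x , nontrivial , comb≡0 = A-dep g g-inj
              in x , nontrivial , λ c → trans (sym (lincomb-cong g x c)) (comb≡0 c)
  where
  lincomb-cong : ∀ {s} (g : Fin s → _) x c → lincomb (A ∘ g) x c ≡ lincomb (B ∘ g) x c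
  lincomb-cong g x c = ∑-cong λ i → cong (x i *_) (A≗B (g i) c)

-- Coefficient sequences of polynomials

-- p c is the coefficient of X^c; the same type also holds coordinate sequences in a basis.
Poly : Set
Poly = ℕ → ℚ

X·_ : Poly → Poly
(X· p) zero    = 0ℚ
(X· p) (suc c) = p c

[X-1]·_ : Poly → Poly
([X-1]· p) c = (X· p) c - p c

δ : ℕ → Poly
δ zero    zero    = 1ℚ
δ zero    (suc c) = 0ℚ
δ (suc a) zero    = 0ℚ
δ (suc a) (suc c) = δ a c

Xᵃ[X-1]ᵇ : ℕ → ℕ → Poly
Xᵃ[X-1]ᵇ a zero    = δ a
Xᵃ[X-1]ᵇ a (suc b) = [X-1]· Xᵃ[X-1]ᵇ a b

Degree≤ : ℕ → Poly → Set
Degree≤ N p = ∀ c → N < c → p c ≡ 0ℚ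

δ-diag : ∀ a → δ a a ≡ 1ℚ
δ-diag zero    = refl
δ-diag (suc a) = δ-diag a

δ-≢ : ∀ {a c} → a ≢ c → δ a c ≡ 0ℚ
δ-≢ {zero}  {zero}  a≢c = ⊥-elim (a≢c refl)
δ-≢ {zero}  {suc c} a≢c = refl
δ-≢ {suc a} {zero}  a≢c = refl
δ-≢ {suc a} {suc c} a≢c = δ-≢ (a≢c ∘ cong suc)

δ-degree : ∀ a → Degree≤ a (δ a)
δ-degree a c a<c = δ-≢ (ℕₚ.<⇒≢ a<c)

Degree≤-mono : ∀ {M N p} → M ≤ N → Degree≤ M p → Degree≤ N p
Degree≤-mono M≤N deg c N<c = deg c (ℕₚ.≤-<-trans M≤N N<c)

[X-1]·-degree : ∀ {N p} → Degree≤ N p → Degree≤ (suc N) ([X-1]· p)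
[X-1]·-degree deg (suc c) (s≤s N<c) = cong₂ _-_ (deg c N<c) (deg (suc c) (ℕₚ.m<n⇒m<1+n N<c))

Xᵃ[X-1]ᵇ-degree : ∀ a b → Degree≤ (b ℕ.+ a) (Xᵃ[X-1]ᵇ a b)
Xᵃ[X-1]ᵇ-degree a zero    = δ-degree a
Xᵃ[X-1]ᵇ-degree a (suc b) = [X-1]·-degree (Xᵃ[X-1]ᵇ-degree a b)

[X-1]ᵇ-degree : ∀ b → Degree≤ b (Xᵃ[X-1]ᵇ 0 b)
[X-1]ᵇ-degree b = subst (λ N → Degree≤ N (Xᵃ[X-1]ᵇ 0 b)) (ℕₚ.+-identityʳ b) (Xᵃ[X-1]ᵇ-degree 0 b)

Xᵃ[X-1]ᵇ-suc : ∀ a b c → Xᵃ[X-1]ᵇ (suc a) b c ≡ (X· Xᵃ[X-1]ᵇ a b) c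
Xᵃ[X-1]ᵇ-suc a zero    zero    = refl
Xᵃ[X-1]ᵇ-suc a zero    (suc c) = refl
Xᵃ[X-1]ᵇ-suc a (suc b) zero    = cong (_-_ 0ℚ) (Xᵃ[X-1]ᵇ-suc a b zero)
Xᵃ[X-1]ᵇ-suc a (suc b) (suc c) = cong₂ _-_ (Xᵃ[X-1]ᵇ-suc a b c) (Xᵃ[X-1]ᵇ-suc a b (suc c))

Xᵃ[X-1]ᵇ-below : ∀ {a c} b → c < a → Xᵃ[X-1]ᵇ a b c ≡ 0ℚ
Xᵃ[X-1]ᵇ-below {suc a} {zero}  b _         = Xᵃ[X-1]ᵇ-suc a b zero
Xᵃ[X-1]ᵇ-below {suc a} {suc c} b (s≤s c<a) = trans (Xᵃ[X-1]ᵇ-suc a b (suc c)) (Xᵃ[X-1]ᵇ-below b c<a)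

Xᵃ[X-1]ᵇ-diag : ∀ a b → Xᵃ[X-1]ᵇ a b a ≡ sgn b
Xᵃ[X-1]ᵇ-diag (suc a) b       = trans (Xᵃ[X-1]ᵇ-suc a b (suc a)) (Xᵃ[X-1]ᵇ-diag a b)
Xᵃ[X-1]ᵇ-diag zero    zero    = refl
Xᵃ[X-1]ᵇ-diag zero    (suc b) = begin
  0ℚ - Xᵃ[X-1]ᵇ 0 b 0 ≡⟨ cong (_-_ 0ℚ) (Xᵃ[X-1]ᵇ-diag 0 b) ⟩
  0ℚ - sgn b          ≡⟨ ℚₚ.+-identityˡ (- sgn b) ⟩
  - sgn b             ≡⟨ sym (sgn-suc b) ⟩
  sgn (suc b)         ∎
  where open ≡-Reasoning

[X-1]ᵇ-coeff : ∀ b c → Xᵃ[X-1]ᵇ 0 b c ≡ sgn (b ℕ.+ c) * toℚ (b C c)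
[X-1]ᵇ-coeff zero    zero    = refl
[X-1]ᵇ-coeff zero    (suc c) = sym (ℚₚ.*-zeroʳ (sgn (suc c)))
[X-1]ᵇ-coeff (suc b) zero    = begin
  0ℚ - Xᵃ[X-1]ᵇ 0 b 0    ≡⟨ cong (_-_ 0ℚ) (trans ([X-1]ᵇ-coeff b 0) (ℚₚ.*-identityʳ (sgn (b ℕ.+ 0)))) ⟩
  0ℚ - sgn (b ℕ.+ 0)     ≡⟨ ℚₚ.+-identityˡ (- sgn (b ℕ.+ 0)) ⟩
  - sgn (b ℕ.+ 0)        ≡⟨ sym (trans (ℚₚ.*-identityʳ (sgn (suc b ℕ.+ 0))) (sgn-suc (b ℕ.+ 0))) ⟩
  sgn (suc b ℕ.+ 0) * 1ℚ ∎
  where open ≡-Reasoning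
[X-1]ᵇ-coeff (suc b) (suc c) = begin
  Xᵃ[X-1]ᵇ 0 b c - Xᵃ[X-1]ᵇ 0 b (suc c)                 ≡⟨ cong₂ _-_ ([X-1]ᵇ-coeff b c) ([X-1]ᵇ-coeff b (suc c)) ⟩
  σ * toℚ (b C c) - sgn (b ℕ.+ suc c) * toℚ (b C suc c) ≡⟨ cong (λ s → σ * toℚ (b C c) - s * toℚ (b C suc c))
                                                                (trans (cong sgn (ℕₚ.+-suc b c)) (sgn-suc (b ℕ.+ c))) ⟩
  σ * toℚ (b C c) - (- σ) * toℚ (b C suc c)             ≡⟨ solve 3 (λ σ x y → σ :* x :- (:- σ) :* y := σ :* (x :+ y))
                                                                   refl σ (toℚ (b C c)) (toℚ (b C suc c)) ⟩
  σ * (toℚ (b C c) + toℚ (b C suc c))                   ≡⟨ cong (σ *_) (sym (toℚ-+ (b C c) (b C suc c))) ⟩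
  σ * toℚ (b C c ℕ.+ b C suc c)                         ≡⟨ cong (λ k → σ * toℚ k) (nCk+nC[k+1]≡[n+1]C[k+1] b c) ⟩
  σ * toℚ (suc b C suc c)                               ≡⟨ cong (λ k → sgn k * toℚ (suc b C suc c)) (cong suc (sym (ℕₚ.+-suc b c))) ⟩
  sgn (suc b ℕ.+ suc c) * toℚ (suc b C suc c)           ∎
  where
  open ≡-Reasoning
  σ = sgn (b ℕ.+ c)

Xᵃ[X-1]ᵇ-coeff : ∀ {a b N c} → a ℕ.+ b ≡ N → c ≤ N → Xᵃ[X-1]ᵇ a b c ≡ sgn (N ℕ.+ c) * toℚ (b C (N ∸ c))
Xᵃ[X-1]ᵇ-coeff {a} {b} {c = c} refl = coeff a c
  where
  coeff : ∀ a c → c ≤ a ℕ.+ b → Xᵃ[X-1]ᵇ a b c ≡ sgn (a ℕ.+ b ℕ.+ c) * toℚ (b C (a ℕ.+ b ∸ c))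
  coeff zero    c       c≤b         = trans ([X-1]ᵇ-coeff b c) (cong (λ k → sgn (b ℕ.+ c) * toℚ k) (nCk≡nC[n∸k] c≤b))
  coeff (suc a) zero    _           = begin
    Xᵃ[X-1]ᵇ (suc a) b 0                              ≡⟨ Xᵃ[X-1]ᵇ-suc a b 0 ⟩
    0ℚ                                                ≡⟨ sym (ℚₚ.*-zeroʳ σ) ⟩
    σ * toℚ 0                                         ≡⟨ cong (λ k → σ * toℚ k) (sym (k>n⇒nCk≡0 (s≤s (ℕₚ.m≤n+m b a)))) ⟩
    σ * toℚ (b C (suc a ℕ.+ b))                       ∎
    where
    open ≡-Reasoning
    σ = sgn (suc a ℕ.+ b ℕ.+ 0)
  coeff (suc a) (suc c) (s≤s c≤a+b) = begin
    Xᵃ[X-1]ᵇ (suc a) b (suc c)                        ≡⟨ Xᵃ[X-1]ᵇ-suc a b (suc c) ⟩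
    Xᵃ[X-1]ᵇ a b c                                    ≡⟨ coeff a c c≤a+b ⟩
    sgn (a ℕ.+ b ℕ.+ c) * toℚ (b C (a ℕ.+ b ∸ c))     ≡⟨ cong (λ k → sgn k * toℚ (b C (a ℕ.+ b ∸ c)))
                                                              (cong suc (sym (ℕₚ.+-suc (a ℕ.+ b) c))) ⟩
    sgn (suc a ℕ.+ b ℕ.+ suc c) * toℚ (b C (a ℕ.+ b ∸ c)) ∎
    where open ≡-Reasoning

-- Coordinates in the basis X^a (X-1)^(N-a)

expand : ℕ → Poly → Poly
expand N v c = ∑ (suc N) (λ a → v (toℕ a) * Xᵃ[X-1]ᵇ (toℕ a) (N ∸ toℕ a) c)

expand-cong : ∀ N {v w} → (∀ a → a ≤ N → v a ≡ w a) → ∀ c → expand N v c ≡ expand N w c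
expand-cong N v≗w c =
  ∑-cong {suc N} λ a → cong (_* Xᵃ[X-1]ᵇ (toℕ a) (N ∸ toℕ a) c) (v≗w (toℕ a) (ℕₚ.≤-pred (Finₚ.toℕ<n a)))

expand-neg : ∀ N v c → expand N (λ a → - v a) c ≡ - expand N v c
expand-neg N v c = trans (∑-cong {suc N} λ a → sym (ℚₚ.neg-distribˡ-* (v (toℕ a)) (P a)))
                         (∑-neg {suc N} (λ a → v (toℕ a) * P a))
  where
  P : Fin (suc N) → ℚ
  P a = Xᵃ[X-1]ᵇ (toℕ a) (N ∸ toℕ a) c

expand-− : ∀ N v w c → expand N (λ a → v a - w a) c ≡ expand N v c - expand N w c
expand-− N v w c = begin
  ∑ (suc N) (λ a → (v (toℕ a) - w (toℕ a)) * P a)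
    ≡⟨ ∑-cong {suc N} (λ a → ℚₚ.*-distribʳ-+ (P a) (v (toℕ a)) (- w (toℕ a))) ⟩
  ∑ (suc N) (λ a → v (toℕ a) * P a + - w (toℕ a) * P a)
    ≡⟨ ∑-distrib-+ (λ a → v (toℕ a) * P a) (λ a → - w (toℕ a) * P a) ⟩
  expand N v c + ∑ (suc N) (λ a → - w (toℕ a) * P a)    ≡⟨ cong (expand N v c +_) (∑-cong {suc N} λ a →
                                                             sym (ℚₚ.neg-distribˡ-* (w (toℕ a)) (P a))) ⟩
  expand N v c + ∑ (suc N) (λ a → - (w (toℕ a) * P a))  ≡⟨ cong (expand N v c +_) (∑-neg {suc N} (λ a → w (toℕ a) * P a)) ⟩
  expand N v c - expand N w c                            ∎
  where
  open ≡-Reasoning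
  P : Fin (suc N) → ℚ
  P a = Xᵃ[X-1]ᵇ (toℕ a) (N ∸ toℕ a) c

expand-δ : ∀ {a N} → a ≤ N → ∀ c → expand N (δ a) c ≡ Xᵃ[X-1]ᵇ a (N ∸ a) c
expand-δ {a} {N} a≤N c = begin
  expand N (δ a) c                                                ≡⟨ ∑-remove (λ b → δ a (toℕ b) * P (toℕ b)) q ⟩
  δ a (toℕ q) * P (toℕ q) + ∑ N (λ j → δ a (toℕ (punchIn q j)) * P (toℕ (punchIn q j)))
    ≡⟨ cong₂ _+_ (cong (λ k → δ a k * P k) toℕ-q)
                 (∑-zero {N} λ j → trans (cong (_* P (toℕ (punchIn q j))) (δ-≢ (a≢punchIn j)))
                                         (ℚₚ.*-zeroˡ (P (toℕ (punchIn q j))))) ⟩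
  δ a a * P a + 0ℚ                                                ≡⟨ cong (λ x → x * P a + 0ℚ) (δ-diag a) ⟩
  1ℚ * P a + 0ℚ                                                   ≡⟨ solve 1 (λ x → con 1ℚ :* x :+ con 0ℚ := x) refl (P a) ⟩
  P a                                                             ∎
  where
  open ≡-Reasoning
  P : ℕ → ℚ
  P b = Xᵃ[X-1]ᵇ b (N ∸ b) c
  q = Fin.fromℕ< (s≤s a≤N)
  toℕ-q : toℕ q ≡ a
  toℕ-q = Finₚ.toℕ-fromℕ< (s≤s a≤N)
  a≢punchIn : ∀ j → a ≢ toℕ (punchIn q j)
  a≢punchIn j a≡ = Finₚ.punchInᵢ≢i q j (Finₚ.toℕ-injective (trans (sym a≡) (sym toℕ-q)))

X·-∑ : ∀ {s} (x : Fin s → ℚ) (P : Fin s → Poly) c →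
       ∑ s (λ a → x a * (X· P a) c) ≡ (X· (λ c′ → ∑ s (λ a → x a * P a c′))) c
X·-∑ x P zero    = ∑-zero λ a → ℚₚ.*-zeroʳ (x a)
X·-∑ x P (suc c) = refl

expand-X· : ∀ N v c → expand (suc N) (X· v) c ≡ (X· expand N v) c
expand-X· N v c = begin
  0ℚ * Xᵃ[X-1]ᵇ 0 (suc N) c + ∑ (suc N) (λ a → v (toℕ a) * Xᵃ[X-1]ᵇ (suc (toℕ a)) (N ∸ toℕ a) c)
    ≡⟨ cong₂ _+_ (ℚₚ.*-zeroˡ (Xᵃ[X-1]ᵇ 0 (suc N) c))
                 (∑-cong {suc N} λ a → cong (v (toℕ a) *_) (Xᵃ[X-1]ᵇ-suc (toℕ a) (N ∸ toℕ a) c)) ⟩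
  0ℚ + ∑ (suc N) (λ a → v (toℕ a) * (X· P a) c) ≡⟨ ℚₚ.+-identityˡ _ ⟩
  ∑ (suc N) (λ a → v (toℕ a) * (X· P a) c)      ≡⟨ X·-∑ (v ∘ toℕ) P c ⟩
  (X· expand N v) c                             ∎
  where
  open ≡-Reasoning
  P : Fin (suc N) → Poly
  P a = Xᵃ[X-1]ᵇ (toℕ a) (N ∸ toℕ a)

expand-[X-1]· : ∀ N v → v (suc N) ≡ 0ℚ → ∀ c → expand (suc N) v c ≡ ([X-1]· expand N v) c
expand-[X-1]· N v v[1+N]≡0 c = begin
  expand (suc N) v c                                                    ≡⟨ ∑-remove F (fromℕ (suc N)) ⟩
  F (fromℕ (suc N)) + ∑ (suc N) (λ j → F (punchIn (fromℕ (suc N)) j))   ≡⟨ cong₂ _+_ last≡0 (∑-cong {suc N} F-punchIn) ⟩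
  0ℚ + ∑ (suc N) (λ j → v (toℕ j) * ((X· P j) c - P j c))               ≡⟨ ℚₚ.+-identityˡ _ ⟩
  ∑ (suc N) (λ j → v (toℕ j) * ((X· P j) c - P j c))
    ≡⟨ ∑-cong {suc N} (λ j → solve 3 (λ v x p → v :* (x :- p) := v :* x :+ (:- (v :* p)))
                                     refl (v (toℕ j)) ((X· P j) c) (P j c)) ⟩
  ∑ (suc N) (λ j → v (toℕ j) * (X· P j) c + - (v (toℕ j) * P j c))
    ≡⟨ ∑-distrib-+ {suc N} (λ j → v (toℕ j) * (X· P j) c) (λ j → - (v (toℕ j) * P j c)) ⟩
  ∑ (suc N) (λ j → v (toℕ j) * (X· P j) c) + ∑ (suc N) (λ j → - (v (toℕ j) * P j c))
    ≡⟨ cong₂ _+_ (X·-∑ (v ∘ toℕ) P c) (∑-neg (λ j → v (toℕ j) * P j c)) ⟩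
  ([X-1]· expand N v) c                                                 ∎
  where
  open ≡-Reasoning
  F : Fin (suc (suc N)) → ℚ
  F a = v (toℕ a) * Xᵃ[X-1]ᵇ (toℕ a) (suc N ∸ toℕ a) c
  P : Fin (suc N) → Poly
  P j = Xᵃ[X-1]ᵇ (toℕ j) (N ∸ toℕ j)
  last≡0 : F (fromℕ (suc N)) ≡ 0ℚ
  last≡0 = trans (cong (λ a → v a * Xᵃ[X-1]ᵇ a (suc N ∸ a) c) (Finₚ.toℕ-fromℕ (suc N)))
                 (trans (cong (_* Xᵃ[X-1]ᵇ (suc N) (suc N ∸ suc N) c) v[1+N]≡0)
                        (ℚₚ.*-zeroˡ (Xᵃ[X-1]ᵇ (suc N) (suc N ∸ suc N) c)))
  F-punchIn : ∀ j → F (punchIn (fromℕ (suc N)) j) ≡ v (toℕ j) * ([X-1]· P j) c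
  F-punchIn j = trans (cong (λ a → v a * Xᵃ[X-1]ᵇ a (suc N ∸ a) c) (toℕ-punchIn-fromℕ j))
                      (cong (λ b → v (toℕ j) * Xᵃ[X-1]ᵇ (toℕ j) b c) (ℕₚ.+-∸-assoc 1 (ℕₚ.≤-pred (Finₚ.toℕ<n j))))

-- X · P − (X − 1) · P = P.
expand-Δ : ∀ N v → Degree≤ N v → ∀ c → expand (suc N) ([X-1]· v) c ≡ expand N v c
expand-Δ N v deg c = begin
  expand (suc N) ([X-1]· v) c
    ≡⟨ expand-− (suc N) (X· v) v c ⟩
  expand (suc N) (X· v) c - expand (suc N) v c
    ≡⟨ cong₂ _-_ (expand-X· N v c) (expand-[X-1]· N v (deg (suc N) ℕₚ.≤-refl) c) ⟩
  (X· expand N v) c - ((X· expand N v) c - expand N v c)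
    ≡⟨ solve 2 (λ x y → x :- (x :- y) := y) refl ((X· expand N v) c) (expand N v c) ⟩
  expand N v c
    ∎
  where open ≡-Reasoning

expand-Xᵃ[X-1]ᵇ : ∀ {a N} b → a ≤ N → ∀ c → expand (b ℕ.+ N) (Xᵃ[X-1]ᵇ a b) c ≡ Xᵃ[X-1]ᵇ a (N ∸ a) c
expand-Xᵃ[X-1]ᵇ         zero    a≤N c = expand-δ a≤N c
expand-Xᵃ[X-1]ᵇ {a} {N} (suc b) a≤N c =
  trans (expand-Δ (b ℕ.+ N) (Xᵃ[X-1]ᵇ a b) (Degree≤-mono (ℕₚ.+-monoʳ-≤ b a≤N) (Xᵃ[X-1]ᵇ-degree a b)) c)
        (expand-Xᵃ[X-1]ᵇ b a≤N c)

-- Row i + 1 of M (n + 2), written in the basis X^a (X-1)^(n-a) with a ≤ n.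
coordRow : ℕ → ℕ → Poly
coordRow n i = if isEven i then (λ a → Xᵃ[X-1]ᵇ (n ∸ i) i a - Xᵃ[X-1]ᵇ 0 i a) else (λ a → - δ i a)

coordRow-even : ∀ {n i} → isEven i ≡ true → ∀ a → coordRow n i a ≡ Xᵃ[X-1]ᵇ (n ∸ i) i a - Xᵃ[X-1]ᵇ 0 i a
coordRow-even even a rewrite even = refl

coordRow-odd : ∀ {n i} → isEven i ≡ false → ∀ a → coordRow n i a ≡ - δ i a
coordRow-odd odd a rewrite odd = refl

expand-coordRow-odd : ∀ {n i} → isEven i ≡ false → i ≤ n → ∀ c →
                      expand n (coordRow n i) c ≡ - Xᵃ[X-1]ᵇ i (n ∸ i) c
expand-coordRow-odd {n} {i} odd i≤n c = begin
  expand n (coordRow n i) c  ≡⟨ expand-cong n (λ a _ → coordRow-odd {n} {i} odd a) c ⟩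
  expand n (λ a → - δ i a) c ≡⟨ expand-neg n (δ i) c ⟩
  - expand n (δ i) c         ≡⟨ cong -_ (expand-δ i≤n c) ⟩
  - Xᵃ[X-1]ᵇ i (n ∸ i) c     ∎
  where open ≡-Reasoning

expand-coordRow-even : ∀ {n i} → isEven i ≡ true → i ≤ n → ∀ c →
                       expand n (coordRow n i) c ≡ δ (n ∸ i) c - Xᵃ[X-1]ᵇ 0 (n ∸ i) c
expand-coordRow-even {n} {i} even i≤n c = begin
  expand n (coordRow n i) c
    ≡⟨ expand-cong n (λ a _ → coordRow-even {n} {i} even a) c ⟩
  expand n (λ a → Xᵃ[X-1]ᵇ m i a - Xᵃ[X-1]ᵇ 0 i a) c
    ≡⟨ expand-− n (Xᵃ[X-1]ᵇ m i) (Xᵃ[X-1]ᵇ 0 i) c ⟩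
  expand n (Xᵃ[X-1]ᵇ m i) c - expand n (Xᵃ[X-1]ᵇ 0 i) c
    ≡⟨ cong (λ N → expand N (Xᵃ[X-1]ᵇ m i) c - expand N (Xᵃ[X-1]ᵇ 0 i) c) (sym (ℕₚ.m+[n∸m]≡n i≤n)) ⟩
  expand (i ℕ.+ m) (Xᵃ[X-1]ᵇ m i) c - expand (i ℕ.+ m) (Xᵃ[X-1]ᵇ 0 i) c
    ≡⟨ cong₂ _-_ (expand-Xᵃ[X-1]ᵇ i ℕₚ.≤-refl c) (expand-Xᵃ[X-1]ᵇ i z≤n c) ⟩
  Xᵃ[X-1]ᵇ m (m ∸ m) c - Xᵃ[X-1]ᵇ 0 m c
    ≡⟨ cong (λ b → Xᵃ[X-1]ᵇ m b c - Xᵃ[X-1]ᵇ 0 m c) (ℕₚ.n∸n≡0 m) ⟩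
  δ m c - Xᵃ[X-1]ᵇ 0 m c
    ∎
  where
  open ≡-Reasoning
  m = n ∸ i

δ-[X-1]ᵇ-coeff : ∀ {m} → sgn m ≡ 1ℚ → ∀ c →
                 δ m c - Xᵃ[X-1]ᵇ 0 m c ≡ (if does (c ℕ.≟ m) then 0ℚ else sgn (suc c) * toℚ (m C c))
δ-[X-1]ᵇ-coeff {m} m-even c = by-cases (c ℕ.≟ m)
  where
  open ≡-Reasoning
  B = toℚ (m C c)
  by-cases : (c≟m : Dec (c ≡ m)) → δ m c - Xᵃ[X-1]ᵇ 0 m c ≡ (if does c≟m then 0ℚ else sgn (suc c) * B)
  by-cases (yes refl) = begin
    δ m m - Xᵃ[X-1]ᵇ 0 m m           ≡⟨ cong₂ _-_ (δ-diag m) ([X-1]ᵇ-coeff m m) ⟩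
    1ℚ - sgn (m ℕ.+ m) * toℚ (m C m) ≡⟨ cong₂ (λ s k → 1ℚ - s * toℚ k) (sgn[n+n] m) (nCn≡1 m) ⟩
    1ℚ - 1ℚ * toℚ 1                  ≡⟨ ℚₚ.+-inverseʳ 1ℚ ⟩
    0ℚ                               ∎
  by-cases (no c≢m) = begin
    δ m c - Xᵃ[X-1]ᵇ 0 m c ≡⟨ cong₂ _-_ (δ-≢ (c≢m ∘ sym)) ([X-1]ᵇ-coeff m c) ⟩
    0ℚ - sgn (m ℕ.+ c) * B ≡⟨ ℚₚ.+-identityˡ _ ⟩
    - (sgn (m ℕ.+ c) * B)  ≡⟨ ℚₚ.neg-distribˡ-* (sgn (m ℕ.+ c)) B ⟩
    - sgn (m ℕ.+ c) * B    ≡⟨ cong (λ s → - s * B) (sgn-+ˡ m m-even c) ⟩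
    - sgn c * B            ≡⟨ cong (_* B) (sym (sgn-suc c)) ⟩
    sgn (suc c) * B        ∎

entry-even : ∀ {k j} r → isEven j ≡ true → entry k j r ≡ sgn r * toℚ ((k ∸ j ∸ 1) C (k ∸ r ∸ 1))
entry-even r even rewrite even = refl

entry-odd : ∀ {k j} r → isEven j ≡ false →
            entry k j r ≡ (if j ℕ.≡ᵇ (k ∸ r) then 0ℚ else sgn r * toℚ ((k ∸ j ∸ 1) C (r ∸ 1)))
entry-odd r odd rewrite odd = refl

suc-∸-pred : ∀ {m n} → m ≤ n → suc n ∸ m ∸ 1 ≡ n ∸ m
suc-∸-pred m≤n = cong (_∸ 1) (ℕₚ.+-∸-assoc 1 m≤n)

1+i≡ᵇ1+n∸c : ∀ {n i c} → i ≤ n → c ≤ n → (suc i ℕ.≡ᵇ (suc n ∸ c)) ≡ does (c ℕ.≟ n ∸ i)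
1+i≡ᵇ1+n∸c {n} {i} {c} i≤n c≤n = by-cases (c ℕ.≟ n ∸ i)
  where
  open ≡-Reasoning
  by-cases : (c≟n∸i : Dec (c ≡ n ∸ i)) → (suc i ℕ.≡ᵇ (suc n ∸ c)) ≡ does c≟n∸i
  by-cases (yes c≡n∸i) = dec-true (suc i ℕ.≟ (suc n ∸ c)) (sym (begin
    suc n ∸ c         ≡⟨ ℕₚ.+-∸-assoc 1 c≤n ⟩
    suc (n ∸ c)       ≡⟨ cong (λ x → suc (n ∸ x)) c≡n∸i ⟩
    suc (n ∸ (n ∸ i)) ≡⟨ cong suc (ℕₚ.m∸[m∸n]≡n i≤n) ⟩
    suc i             ∎))
  by-cases (no c≢n∸i) = dec-false (suc i ℕ.≟ (suc n ∸ c)) λ eq → c≢n∸i (sym (begin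
    n ∸ i             ≡⟨ cong (n ∸_) (ℕₚ.suc-injective (trans eq (ℕₚ.+-∸-assoc 1 c≤n))) ⟩
    n ∸ (n ∸ c)       ≡⟨ ℕₚ.m∸[m∸n]≡n c≤n ⟩
    c                 ∎))

entry-row-odd : ∀ {n i c} → sgn n ≡ 1ℚ → isEven i ≡ false → i ≤ n → c ≤ n →
                entry (suc (suc n)) (suc i) (suc c) ≡ - Xᵃ[X-1]ᵇ i (n ∸ i) c
entry-row-odd {n} {i} {c} n-even odd i≤n c≤n = begin
  entry (suc (suc n)) (suc i) (suc c)
    ≡⟨ entry-even {suc (suc n)} {suc i} (suc c) (trans (isEven-suc i) (cong not odd)) ⟩
  sgn (suc c) * toℚ ((suc n ∸ i ∸ 1) C (suc n ∸ c ∸ 1))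
    ≡⟨ cong₂ (λ x y → sgn (suc c) * toℚ (x C y)) (suc-∸-pred i≤n) (suc-∸-pred c≤n) ⟩
  sgn (suc c) * B
    ≡⟨ cong (_* B) (trans (sgn-suc c) (cong -_ (sym (sgn-+ˡ n n-even c)))) ⟩
  - sgn (n ℕ.+ c) * B
    ≡⟨ sym (ℚₚ.neg-distribˡ-* (sgn (n ℕ.+ c)) B) ⟩
  - (sgn (n ℕ.+ c) * B)
    ≡⟨ cong -_ (sym (Xᵃ[X-1]ᵇ-coeff {i} {n ∸ i} (ℕₚ.m+[n∸m]≡n i≤n) c≤n)) ⟩
  - Xᵃ[X-1]ᵇ i (n ∸ i) c
    ∎
  where
  open ≡-Reasoning
  B = toℚ ((n ∸ i) C (n ∸ c))

entry-row-even : ∀ {n i c} → sgn n ≡ 1ℚ → isEven i ≡ true → i ≤ n → c ≤ n →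
                 entry (suc (suc n)) (suc i) (suc c) ≡ δ (n ∸ i) c - Xᵃ[X-1]ᵇ 0 (n ∸ i) c
entry-row-even {n} {i} {c} n-even even i≤n c≤n = begin
  entry (suc (suc n)) (suc i) (suc c)
    ≡⟨ entry-odd {suc (suc n)} {suc i} (suc c) (trans (isEven-suc i) (cong not even)) ⟩
  (if suc i ℕ.≡ᵇ (suc n ∸ c) then 0ℚ else sgn (suc c) * toℚ ((suc n ∸ i ∸ 1) C c))
    ≡⟨ cong₂ (λ b k → if b then 0ℚ else sgn (suc c) * toℚ (k C c)) (1+i≡ᵇ1+n∸c i≤n c≤n) (suc-∸-pred i≤n) ⟩
  (if does (c ℕ.≟ n ∸ i) then 0ℚ else sgn (suc c) * toℚ ((n ∸ i) C c))
    ≡⟨ sym (δ-[X-1]ᵇ-coeff (trans (sgn-∸ i≤n) (cong₂ _*_ n-even (isEven⇒sgn≡1 {i} even))) c) ⟩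
  δ (n ∸ i) c - Xᵃ[X-1]ᵇ 0 (n ∸ i) c
    ∎
  where open ≡-Reasoning

entry≡expand-coordRow : ∀ {n i c} → sgn n ≡ 1ℚ → i ≤ n → c ≤ n →
                        entry (suc (suc n)) (suc i) (suc c) ≡ expand n (coordRow n i) c
entry≡expand-coordRow {n} {i} {c} n-even i≤n c≤n = by-parity (isEven i) refl
  where
  by-parity : ∀ b → isEven i ≡ b → entry (suc (suc n)) (suc i) (suc c) ≡ expand n (coordRow n i) c
  by-parity true  even = trans (entry-row-even {n} {i} n-even even i≤n c≤n) (sym (expand-coordRow-even {n} {i} even i≤n c))
  by-parity false odd  = trans (entry-row-odd {n} {i} n-even odd i≤n c≤n) (sym (expand-coordRow-odd {n} {i} odd i≤n c))

basisMatrix : (n : ℕ) → Matrix (suc n) (suc n)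
basisMatrix n a c = Xᵃ[X-1]ᵇ (toℕ a) (n ∸ toℕ a) (toℕ c)

basisMatrix-LinIndep : ∀ n → LinIndep (basisMatrix n)
basisMatrix-LinIndep n = lowerTriangular⇒LinIndep (basisMatrix n) (λ a → a)
  (λ c a c<a → Xᵃ[X-1]ᵇ-below (n ∸ toℕ a) c<a)
  (λ a → subst (_≢ 0ℚ) (sym (Xᵃ[X-1]ᵇ-diag (toℕ a) (n ∸ toℕ a))) (sgn≢0 (n ∸ toℕ a)))

coordMatrix : (n : ℕ) → Matrix n (suc n)
coordMatrix n i a = coordRow n (toℕ i) (toℕ a)

coordMatrix·basisMatrix≗M : ∀ n → sgn n ≡ 1ℚ → ∀ j c → (coordMatrix n · basisMatrix n) j c ≡ M (suc (suc n)) j c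
coordMatrix·basisMatrix≗M n n-even j c =
  sym (entry≡expand-coordRow n-even (ℕₚ.<⇒≤ (Finₚ.toℕ<n j)) (ℕₚ.≤-pred (Finₚ.toℕ<n c)))

EvenAntisymmetric : ℕ → Poly → Set
EvenAntisymmetric n w = ∀ a → a ≤ n → sgn a ≡ 1ℚ → w a + w (n ∸ a) ≡ 0ℚ

coordRow-antisymmetric : ∀ {n i a} → sgn n ≡ 1ℚ → isEven i ≡ true → i ≤ n → a ≤ n →
                         coordRow n i a + coordRow n i (n ∸ a) ≡ 0ℚ
coordRow-antisymmetric {n} {i} {a} n-even even i≤n a≤n = begin
  coordRow n i a + coordRow n i (n ∸ a) ≡⟨ cong₂ _+_ (coordRow-even {n} {i} even a) (coordRow-even {n} {i} even (n ∸ a)) ⟩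
  (U a - W a) + (U (n ∸ a) - W (n ∸ a)) ≡⟨ cong₂ _+_ (cong₂ _-_ U-a W-a) (cong₂ _-_ U-n∸a W-n∸a) ⟩
  (σ * P - σ * Q) + (σ * Q - σ * P)     ≡⟨ solve 3 (λ σ p q → (σ :* p :- σ :* q) :+ (σ :* q :- σ :* p) := con 0ℚ)
                                                 refl σ P Q ⟩
  0ℚ                                    ∎
  where
  open ≡-Reasoning
  U W : Poly
  U = Xᵃ[X-1]ᵇ (n ∸ i) i
  W = Xᵃ[X-1]ᵇ 0 i
  σ = sgn a
  P = toℚ (i C (n ∸ a))
  Q = toℚ (i C a)
  i-even : sgn i ≡ 1ℚ
  i-even = isEven⇒sgn≡1 {i} even
  sgn-n∸a : sgn (n ∸ a) ≡ σ
  sgn-n∸a = trans (sgn-∸ a≤n) (trans (cong (_* σ) n-even) (ℚₚ.*-identityˡ σ))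
  U-a : U a ≡ σ * P
  U-a = trans (Xᵃ[X-1]ᵇ-coeff {n ∸ i} {i} (ℕₚ.m∸n+n≡m i≤n) a≤n) (cong (_* P) (sgn-+ˡ n n-even a))
  U-n∸a : U (n ∸ a) ≡ σ * Q
  U-n∸a = trans (Xᵃ[X-1]ᵇ-coeff {n ∸ i} {i} (ℕₚ.m∸n+n≡m i≤n) (ℕₚ.m∸n≤m n a))
                (cong₂ (λ s k → s * toℚ (i C k)) (trans (sgn-+ˡ n n-even (n ∸ a)) sgn-n∸a) (ℕₚ.m∸[m∸n]≡n a≤n))
  W-a : W a ≡ σ * Q
  W-a = trans ([X-1]ᵇ-coeff i a) (cong (_* Q) (sgn-+ˡ i i-even a))
  W-n∸a : W (n ∸ a) ≡ σ * P
  W-n∸a = trans ([X-1]ᵇ-coeff i (n ∸ a)) (cong (_* P) (trans (sgn-+ˡ i i-even (n ∸ a)) sgn-n∸a))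

coordRow-EvenAntisymmetric : ∀ {n i} → sgn n ≡ 1ℚ → i ≤ n → EvenAntisymmetric n (coordRow n i)
coordRow-EvenAntisymmetric {n} {i} n-even i≤n a a≤n a-even = by-parity (isEven i) refl
  where
  by-parity : ∀ b → isEven i ≡ b → coordRow n i a + coordRow n i (n ∸ a) ≡ 0ℚ
  by-parity true  even = coordRow-antisymmetric n-even even i≤n a≤n
  by-parity false odd  = cong₂ _+_ (vanishes a a-even) (vanishes (n ∸ a) (trans (sgn-∸ a≤n) (cong₂ _*_ n-even a-even)))
    where
    vanishes : ∀ c → sgn c ≡ 1ℚ → coordRow n i c ≡ 0ℚ
    vanishes c c-even = trans (coordRow-odd {n} {i} odd c) (cong -_ (δ-≢ {i} {c} λ i≡c →
      1≢-1 (trans (sym c-even) (trans (cong sgn (sym i≡c)) (isOdd⇒sgn≡-1 {i} odd)))))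

lincomb-EvenAntisymmetric : ∀ {s n} (P : Fin s → Poly) (x : Fin s → ℚ) → (∀ t → EvenAntisymmetric n (P t)) →
                            EvenAntisymmetric n (λ a → ∑ s (λ t → x t * P t a))
lincomb-EvenAntisymmetric {s} {n} P x anti a a≤n a-even =
  trans (sym (∑-distrib-+ (λ t → x t * P t a) (λ t → x t * P t (n ∸ a))))
        (∑-zero λ t → trans (sym (ℚₚ.*-distribˡ-+ (x t) (P t a) (P t (n ∸ a))))
                            (trans (cong (x t *_) (anti t a a≤n a-even)) (ℚₚ.*-zeroʳ (x t))))

-- Rank of the coordinate matrix

-- For n = 2h and h ≤ 2d ≤ h + 1: the h odd rows 1, 3, …, 2h − 1, each pivoted at its own index,
-- followed by the d even rows 0, 2, …, 2d − 2, row 2y pivoted at n − 2y.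
module Selection (h d : ℕ) (h≤d+d : h ≤ d ℕ.+ d) (d+d≤1+h : d ℕ.+ d ≤ suc h) where

  n ρ : ℕ
  n = h ℕ.+ h
  ρ = h ℕ.+ d

  n-even : sgn n ≡ 1ℚ
  n-even = sgn[n+n] h

  data Half : ℕ → Set where
    first  : ∀ {u} → u < h → Half u
    second : ∀ y → Half (h ℕ.+ y)

  half : ∀ t → Half t
  half t with t ℕ.<? h
  ... | yes t<h = first t<h
  ... | no  t≮h = subst Half (ℕₚ.m+[n∸m]≡n (ℕₚ.≮⇒≥ t≮h)) (second (t ∸ h))

  byHalf : (ℕ → ℕ) → (ℕ → ℕ) → ℕ → ℕ
  byHalf f g t = if does (t ℕ.<? h) then f t else g (t ∸ h)

  byHalf-first : ∀ f g {u} → u < h → byHalf f g u ≡ f u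
  byHalf-first f g {u} u<h = cong (λ b → if b then f u else g (u ∸ h)) (dec-true (u ℕ.<? h) u<h)

  byHalf-second : ∀ f g y → byHalf f g (h ℕ.+ y) ≡ g y
  byHalf-second f g y = begin
    byHalf f g (h ℕ.+ y) ≡⟨ cong (λ b → if b then f (h ℕ.+ y) else g (h ℕ.+ y ∸ h))
                                 (dec-false ((h ℕ.+ y) ℕ.<? h) (ℕₚ.≤⇒≯ (ℕₚ.m≤m+n h y))) ⟩
    g (h ℕ.+ y ∸ h)      ≡⟨ cong g (ℕₚ.m+n∸m≡n h y) ⟩
    g y                  ∎
    where open ≡-Reasoning

  row pivot : ℕ → ℕ
  row   = byHalf (λ u → suc (u ℕ.+ u)) (λ y → y ℕ.+ y)
  pivot = byHalf (λ u → suc (u ℕ.+ u)) (λ y → n ∸ (y ℕ.+ y))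

  row-first : ∀ {u} → u < h → row u ≡ suc (u ℕ.+ u)
  row-first = byHalf-first (λ u → suc (u ℕ.+ u)) (λ y → y ℕ.+ y)

  row-second : ∀ y → row (h ℕ.+ y) ≡ y ℕ.+ y
  row-second = byHalf-second (λ u → suc (u ℕ.+ u)) (λ y → y ℕ.+ y)

  pivot-first : ∀ {u} → u < h → pivot u ≡ suc (u ℕ.+ u)
  pivot-first = byHalf-first (λ u → suc (u ℕ.+ u)) (λ y → n ∸ (y ℕ.+ y))

  pivot-second : ∀ y → pivot (h ℕ.+ y) ≡ n ∸ (y ℕ.+ y)
  pivot-second = byHalf-second (λ u → suc (u ℕ.+ u)) (λ y → n ∸ (y ℕ.+ y))

  u<h⇒double+1<n : ∀ {u} → u < h → suc (u ℕ.+ u) < n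
  u<h⇒double+1<n {u} u<h = subst (_≤ n) (cong suc (ℕₚ.+-suc u u)) (ℕₚ.+-mono-≤ u<h u<h)

  y<d⇒double<h : ∀ {y} → y < d → y ℕ.+ y < h
  y<d⇒double<h {y} y<d =
    ℕₚ.≤-pred (subst (_≤ suc h) (cong suc (ℕₚ.+-suc y y)) (ℕₚ.≤-trans (ℕₚ.+-mono-≤ y<d y<d) d+d≤1+h))

  y<d⇒double<n : ∀ {y} → y < d → y ℕ.+ y < n
  y<d⇒double<n y<d = ℕₚ.<-≤-trans (y<d⇒double<h y<d) (ℕₚ.m≤m+n h h)

  h+y<ρ⇒y<d : ∀ {y} → h ℕ.+ y < ρ → y < d
  h+y<ρ⇒y<d = ℕₚ.+-cancelˡ-< h _ _

  row<n : ∀ t → t < ρ → row t < n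
  row<n t t<ρ with half t
  ... | first u<h = subst (_< n) (sym (row-first u<h)) (u<h⇒double+1<n u<h)
  ... | second y  = subst (_< n) (sym (row-second y)) (y<d⇒double<n (h+y<ρ⇒y<d t<ρ))

  pivot≤n : ∀ t → pivot t ≤ n
  pivot≤n t with half t
  ... | first u<h = subst (_≤ n) (sym (pivot-first u<h)) (ℕₚ.<⇒≤ (u<h⇒double+1<n u<h))
  ... | second y  = subst (_≤ n) (sym (pivot-second y)) (ℕₚ.m∸n≤m n (y ℕ.+ y))

  coordRow-double+1 : ∀ u a → coordRow n (suc (u ℕ.+ u)) a ≡ - δ (suc (u ℕ.+ u)) a
  coordRow-double+1 u = coordRow-odd {n} {suc (u ℕ.+ u)} (trans (isEven-suc (u ℕ.+ u)) (cong not (isEven-double u)))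

  coordRow-double : ∀ y a → coordRow n (y ℕ.+ y) a ≡ Xᵃ[X-1]ᵇ (n ∸ (y ℕ.+ y)) (y ℕ.+ y) a - Xᵃ[X-1]ᵇ 0 (y ℕ.+ y) a
  coordRow-double y = coordRow-even {n} {y ℕ.+ y} (isEven-double y)

  double<n∸double : ∀ {y′ y} → y′ ≤ y → y < d → y′ ℕ.+ y′ < n ∸ (y ℕ.+ y)
  double<n∸double {y′} {y} y′≤y y<d = ℕₚ.m+n≤o⇒m≤o∸n (suc (y′ ℕ.+ y′))
    (ℕₚ.+-mono-< (ℕₚ.≤-<-trans (ℕₚ.+-mono-≤ y′≤y y′≤y) (y<d⇒double<h y<d)) (y<d⇒double<h y<d))

  oddRow-vanishes : ∀ {u c} → suc (u ℕ.+ u) ≢ c → coordRow n (suc (u ℕ.+ u)) c ≡ 0ℚ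
  oddRow-vanishes {u} {c} ne = trans (coordRow-double+1 u c) (cong -_ (δ-≢ ne))

  evenRow-vanishes : ∀ {y′ y} → y′ < y → y < d → coordRow n (y′ ℕ.+ y′) (n ∸ (y ℕ.+ y)) ≡ 0ℚ
  evenRow-vanishes {y′} {y} y′<y y<d = begin
    coordRow n (y′ ℕ.+ y′) c                                             ≡⟨ coordRow-double y′ c ⟩
    Xᵃ[X-1]ᵇ (n ∸ (y′ ℕ.+ y′)) (y′ ℕ.+ y′) c - Xᵃ[X-1]ᵇ 0 (y′ ℕ.+ y′) c ≡⟨ cong₂ _-_ (Xᵃ[X-1]ᵇ-below (y′ ℕ.+ y′) c<n∸2y′)
                                                                                      ([X-1]ᵇ-degree (y′ ℕ.+ y′) c 2y′<c) ⟩
    0ℚ - 0ℚ                                                              ≡⟨⟩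
    0ℚ                                                                   ∎
    where
    open ≡-Reasoning
    c = n ∸ (y ℕ.+ y)
    c<n∸2y′ : c < n ∸ (y′ ℕ.+ y′)
    c<n∸2y′ = ℕₚ.∸-monoʳ-< (ℕₚ.+-mono-< y′<y y′<y) (ℕₚ.<⇒≤ (y<d⇒double<n y<d))
    2y′<c : y′ ℕ.+ y′ < c
    2y′<c = double<n∸double (ℕₚ.<⇒≤ y′<y) y<d

  evenRow-diag : ∀ {y} → y < d → coordRow n (y ℕ.+ y) (n ∸ (y ℕ.+ y)) ≡ 1ℚ
  evenRow-diag {y} y<d = begin
    coordRow n (y ℕ.+ y) c                          ≡⟨ coordRow-double y c ⟩
    Xᵃ[X-1]ᵇ c (y ℕ.+ y) c - Xᵃ[X-1]ᵇ 0 (y ℕ.+ y) c ≡⟨ cong₂ _-_ (trans (Xᵃ[X-1]ᵇ-diag c (y ℕ.+ y)) (sgn[n+n] y))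
                                                                 ([X-1]ᵇ-degree (y ℕ.+ y) c (double<n∸double ℕₚ.≤-refl y<d)) ⟩
    1ℚ - 0ℚ                                         ≡⟨⟩
    1ℚ                                              ∎
    where
    open ≡-Reasoning
    c = n ∸ (y ℕ.+ y)

  row-injective : ∀ {t t′} → row t ≡ row t′ → t ≡ t′
  row-injective {t} {t′} eq with half t | half t′
  ... | first u<h | first v<h =
    double-injective (ℕₚ.suc-injective (trans (sym (row-first u<h)) (trans eq (row-first v<h))))
  ... | first u<h | second y  =
    ⊥-elim (double+1≢double t y (trans (sym (row-first u<h)) (trans eq (row-second y))))
  ... | second y  | first v<h =
    ⊥-elim (double+1≢double t′ y (trans (sym (row-first v<h)) (trans (sym eq) (row-second y))))
  ... | second y  | second y′ =
    cong (h ℕ.+_) (double-injective (trans (sym (row-second y)) (trans eq (row-second y′))))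

  selection-upper : ∀ {i l} → i < l → l < ρ → coordRow n (row i) (pivot l) ≡ 0ℚ
  selection-upper {i} {l} i<l l<ρ with half i | half l
  ... | first u<h | first v<h = trans (cong₂ (coordRow n) (row-first u<h) (pivot-first v<h))
                                      (oddRow-vanishes {i} (ℕₚ.<⇒≢ i<l ∘ double-injective ∘ ℕₚ.suc-injective))
  ... | first u<h | second y  = trans (cong₂ (coordRow n) (row-first u<h) (pivot-second y))
                                      (oddRow-vanishes {i} λ e → double+1≢double i (h ∸ y) (trans e (double-∸ h y)))
  ... | second y′ | first v<h = ⊥-elim (ℕₚ.<⇒≱ (ℕₚ.<-trans i<l v<h) (ℕₚ.m≤m+n h y′))
  ... | second y′ | second y  = trans (cong₂ (coordRow n) (row-second y′) (pivot-second y))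
                                      (evenRow-vanishes (ℕₚ.+-cancelˡ-< h y′ y i<l) (h+y<ρ⇒y<d l<ρ))

  selection-diag : ∀ {t} → t < ρ → coordRow n (row t) (pivot t) ≢ 0ℚ
  selection-diag {t} t<ρ with half t
  ... | first {u} u<h = subst (_≢ 0ℚ) (sym (begin
    coordRow n (row u) (pivot u)               ≡⟨ cong₂ (coordRow n) (row-first u<h) (pivot-first u<h) ⟩
    coordRow n (suc (u ℕ.+ u)) (suc (u ℕ.+ u)) ≡⟨ coordRow-double+1 u (suc (u ℕ.+ u)) ⟩
    - δ (suc (u ℕ.+ u)) (suc (u ℕ.+ u))        ≡⟨ cong -_ (δ-diag (suc (u ℕ.+ u))) ⟩
    - 1ℚ                                       ∎)) (λ ())
    where open ≡-Reasoning
  ... | second y = subst (_≢ 0ℚ) (sym (trans (cong₂ (coordRow n) (row-second y) (pivot-second y))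
                                             (evenRow-diag (h+y<ρ⇒y<d t<ρ))))
                         ℚₚ.1≢0

  double≡h : ∀ {u} → u ≤ h → d ≤ u → d ≤ h ∸ u → u ℕ.+ u ≡ h
  double≡h {u} u≤h d≤u d≤h∸u = ℕₚ.≤-antisym u+u≤h (ℕₚ.≤-trans h≤d+d (ℕₚ.+-mono-≤ d≤u d≤u))
    where
    u+[h∸u]≡h : u ℕ.+ (h ∸ u) ≡ h
    u+[h∸u]≡h = ℕₚ.m+[n∸m]≡n u≤h
    u≤d : u ≤ d
    u≤d = ℕₚ.+-cancelʳ-≤ d u d (ℕₚ.≤-trans (subst (u ℕ.+ d ≤_) u+[h∸u]≡h (ℕₚ.+-monoʳ-≤ u d≤h∸u)) h≤d+d)
    u+u≤h : u ℕ.+ u ≤ h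
    u+u≤h = subst (u ℕ.+ u ≤_) u+[h∸u]≡h (ℕₚ.+-monoʳ-≤ u (ℕₚ.≤-trans u≤d d≤h∸u))

  pivots-determine : ∀ w → EvenAntisymmetric n w → (∀ t → t < ρ → w (pivot t) ≡ 0ℚ) →
                     ∀ a → a ≤ n → w a ≡ 0ℚ
  pivots-determine w anti vanish a a≤n with parity a
  ... | twice+1 u = trans (cong w (sym (pivot-first u<h))) (vanish u (ℕₚ.<-≤-trans u<h (ℕₚ.m≤m+n h d)))
    where u<h = double+1-cancel-< a≤n
  ... | twice u with (h ∸ u) ℕ.<? d | u ℕ.<? d
  ...   | yes h∸u<d | _ = trans (cong w (sym pivot≡u+u)) (vanish (h ℕ.+ (h ∸ u)) (ℕₚ.+-monoʳ-< h h∸u<d))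
    where
    pivot≡u+u : pivot (h ℕ.+ (h ∸ u)) ≡ u ℕ.+ u
    pivot≡u+u = trans (pivot-second (h ∸ u))
                      (trans (double-∸ h (h ∸ u)) (cong (λ v → v ℕ.+ v) (ℕₚ.m∸[m∸n]≡n (double-cancel-≤ {u} {h} a≤n))))
  ...   | no _ | yes u<d = begin
    w (u ℕ.+ u)                     ≡⟨ sym (ℚₚ.+-identityʳ _) ⟩
    w (u ℕ.+ u) + 0ℚ                ≡⟨ cong (w (u ℕ.+ u) +_) (sym mirror≡0) ⟩
    w (u ℕ.+ u) + w (n ∸ (u ℕ.+ u)) ≡⟨ anti (u ℕ.+ u) a≤n (sgn[n+n] u) ⟩
    0ℚ                              ∎
    where
    open ≡-Reasoning
    mirror≡0 : w (n ∸ (u ℕ.+ u)) ≡ 0ℚ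
    mirror≡0 = trans (cong w (sym (pivot-second u))) (vanish (h ℕ.+ u) (ℕₚ.+-monoʳ-< h u<d))
  ...   | no h∸u≮d | no u≮d =
    x+x≡0⇒x≡0 (trans (cong (λ b → w (u ℕ.+ u) + w b) (sym n∸[u+u]≡u+u)) (anti (u ℕ.+ u) a≤n (sgn[n+n] u)))
    where
    u+u≡h : u ℕ.+ u ≡ h
    u+u≡h = double≡h (double-cancel-≤ a≤n) (ℕₚ.≮⇒≥ u≮d) (ℕₚ.≮⇒≥ h∸u≮d)
    n∸[u+u]≡u+u : n ∸ (u ℕ.+ u) ≡ u ℕ.+ u
    n∸[u+u]≡u+u = trans (cong (n ∸_) u+u≡h) (trans (ℕₚ.m+n∸m≡n h h) (sym u+u≡h))

  rowFin : Fin ρ → Fin n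
  rowFin t = Fin.fromℕ< (row<n (toℕ t) (Finₚ.toℕ<n t))

  pivotFin : Fin ρ → Fin (suc n)
  pivotFin t = Fin.fromℕ< (s≤s (pivot≤n (toℕ t)))

  toℕ-rowFin : ∀ t → toℕ (rowFin t) ≡ row (toℕ t)
  toℕ-rowFin t = Finₚ.toℕ-fromℕ< _

  toℕ-pivotFin : ∀ t → toℕ (pivotFin t) ≡ pivot (toℕ t)
  toℕ-pivotFin t = Finₚ.toℕ-fromℕ< _

  rowFin-injective : Injective _≡_ _≡_ rowFin
  rowFin-injective {t} {t′} eq =
    Finₚ.toℕ-injective (row-injective (trans (sym (toℕ-rowFin t)) (trans (cong toℕ eq) (toℕ-rowFin t′))))

  selected-LinIndep : LinIndep (coordMatrix n ∘ rowFin)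
  selected-LinIndep = upperTriangular⇒LinIndep (coordMatrix n ∘ rowFin) pivotFin
    (λ l i i<l → trans (cong₂ (coordRow n) (toℕ-rowFin i) (toℕ-pivotFin l)) (selection-upper i<l (Finₚ.toℕ<n l)))
    (λ t → subst (_≢ 0ℚ) (sym (cong₂ (coordRow n) (toℕ-rowFin t) (toℕ-pivotFin t))) (selection-diag (Finₚ.toℕ<n t)))

  coordMatrix-LinDep : ∀ (g : Fin (suc ρ) → Fin n) → LinDep (coordMatrix n ∘ g)
  coordMatrix-LinDep g = determined⇒LinDep (coordMatrix n ∘ g) pivotFin ℕₚ.≤-refl λ x vanish c →
    let w : Poly
        w a = ∑ (suc ρ) (λ t → x t * coordRow n (toℕ (g t)) a)
        w-anti = lincomb-EvenAntisymmetric (λ t → coordRow n (toℕ (g t))) x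
                   (λ t → coordRow-EvenAntisymmetric n-even (ℕₚ.<⇒≤ (Finₚ.toℕ<n (g t))))
        pivot-fromℕ< : ∀ {t} (t<ρ : t < ρ) → pivot t ≡ toℕ (pivotFin (Fin.fromℕ< t<ρ))
        pivot-fromℕ< t<ρ = trans (cong pivot (sym (Finₚ.toℕ-fromℕ< t<ρ))) (sym (toℕ-pivotFin (Fin.fromℕ< t<ρ)))
    in pivots-determine w w-anti (λ t t<ρ → trans (cong w (pivot-fromℕ< t<ρ)) (vanish (Fin.fromℕ< t<ρ)))
                        (toℕ c) (ℕₚ.≤-pred (Finₚ.toℕ<n c))

  coordMatrix-HasRank : HasRank (coordMatrix n) ρ
  coordMatrix-HasRank = (rowFin , rowFin-injective , selected-LinIndep) , λ g _ → coordMatrix-LinDep g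

M-HasRank : ∀ h d → h ≤ d ℕ.+ d → d ℕ.+ d ≤ suc h → HasRank (M (suc (suc (h ℕ.+ h)))) (h ℕ.+ d)
M-HasRank h d h≤d+d d+d≤1+h =
  HasRank-cong (coordMatrix·basisMatrix≗M n n-even)
               (HasRank-·-LinIndep (coordMatrix n) (basisMatrix n) (basisMatrix-LinIndep n) coordMatrix-HasRank)
  where open Selection h d h≤d+d d+d≤1+h

3k/4∸1-twice : ∀ q → 3 ℕ.* (2 ℕ.+ ((q ℕ.+ q) ℕ.+ (q ℕ.+ q))) ℕ./ 4 ∸ 1 ≡ (q ℕ.+ q) ℕ.+ q
3k/4∸1-twice q = cong (_∸ 1) (begin
  3 ℕ.* (2 ℕ.+ ((q ℕ.+ q) ℕ.+ (q ℕ.+ q))) ℕ./ 4 ≡⟨ cong (ℕ._/ 4) (3k≡ q) ⟩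
  (suc r ℕ.* 4 ℕ.+ 2) ℕ./ 4                     ≡⟨ DivMod.+-distrib-/-∣ˡ {suc r ℕ.* 4} 2 {4} (divides-refl (suc r)) ⟩
  suc r ℕ.* 4 ℕ./ 4 ℕ.+ 0                       ≡⟨ ℕₚ.+-identityʳ _ ⟩
  suc r ℕ.* 4 ℕ./ 4                             ≡⟨ DivMod.m*n/n≡m (suc r) 4 ⟩
  suc r                                         ∎)
  where
  open ≡-Reasoning
  r = (q ℕ.+ q) ℕ.+ q
  3k≡ : ∀ q → 3 ℕ.* (2 ℕ.+ ((q ℕ.+ q) ℕ.+ (q ℕ.+ q))) ≡ suc ((q ℕ.+ q) ℕ.+ q) ℕ.* 4 ℕ.+ 2
  3k≡ = solve-∀

3k/4∸1-twice+1 : ∀ q → 3 ℕ.* (2 ℕ.+ (suc (q ℕ.+ q) ℕ.+ suc (q ℕ.+ q))) ℕ./ 4 ∸ 1 ≡ suc (q ℕ.+ q) ℕ.+ suc q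
3k/4∸1-twice+1 q = cong (_∸ 1) (trans (cong (ℕ._/ 4) (3k≡ q)) (DivMod.m*n/n≡m (suc (suc (q ℕ.+ q) ℕ.+ suc q)) 4))
  where
  3k≡ : ∀ q → 3 ℕ.* (2 ℕ.+ (suc (q ℕ.+ q) ℕ.+ suc (q ℕ.+ q))) ≡ suc (suc (q ℕ.+ q) ℕ.+ suc q) ℕ.* 4
  3k≡ = solve-∀

M-HasRank-3k/4∸1 : ∀ h → HasRank (M (2 ℕ.+ (h ℕ.+ h))) (3 ℕ.* (2 ℕ.+ (h ℕ.+ h)) ℕ./ 4 ∸ 1)
M-HasRank-3k/4∸1 h with parity h
... | twice q   = subst (HasRank (M (2 ℕ.+ ((q ℕ.+ q) ℕ.+ (q ℕ.+ q))))) (sym (3k/4∸1-twice q))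
                        (M-HasRank (q ℕ.+ q) q ℕₚ.≤-refl (ℕₚ.n≤1+n _))
... | twice+1 q = subst (HasRank (M (2 ℕ.+ (suc (q ℕ.+ q) ℕ.+ suc (q ℕ.+ q))))) (sym (3k/4∸1-twice+1 q))
                        (M-HasRank (suc (q ℕ.+ q)) (suc q) (ℕₚ.≤-trans (ℕₚ.n≤1+n _) (ℕₚ.≤-reflexive (sym [1+q]+[1+q])))
                                                            (ℕₚ.≤-reflexive [1+q]+[1+q]))
  where
  [1+q]+[1+q] : suc q ℕ.+ suc q ≡ suc (suc (q ℕ.+ q))
  [1+q]+[1+q] = cong suc (ℕₚ.+-suc q q)

proposition4p3 : (k : ℕ) → 2 ∣ k → 2 ≤ k → HasRank (M k) ((3 ℕ.* k) ℕ./ 4 ∸ 1)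
proposition4p3 .0             (divides zero    refl) ()
proposition4p3 .(suc h ℕ.* 2) (divides (suc h) refl) _ =
  subst (λ m → HasRank (M (2 ℕ.+ m)) (3 ℕ.* (2 ℕ.+ m) ℕ./ 4 ∸ 1)) (h+h≡h*2 h) (M-HasRank-3k/4∸1 h)
  where
  h+h≡h*2 : ∀ h → h ℕ.+ h ≡ h ℕ.* 2
  h+h≡h*2 = solve-∀
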